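{- In the setting described in the context, for all $0\le h,i,j\le D$, \[p^h_{i,j}=p^h_{j,i},\qquad k_hp^h_{i,j}=k_jp^j_{h,i}=k_ip^i_{j,h}.\]
   Context: Let $D$ be a positive integer. Define $c_i=\frac{3(D-i+1)i(D+i+1)}{D(D+2)(2i+1)}$ ($1\le i\le D$), $a_i=\frac{3i(i+1)}{D(D+2)}$ ($0\le i\le D$), $b_i=\frac{3(D-i)(i+1)(D+i+2)}{D(D+2)(2i+1)}$ ($0\le i\le D-1$). Matrices are $(D+1)\times(D+1)$ real, indices $0,\dots,D$. $A$ is the tridiagonal matrix with $A_{i,i}=a_i$, $A_{i,i+1}=b_i$, $A_{i,i-1}=c_i$, other entries $0$. Polynomials $u_0,\dots,u_D$: $u_0=1$, $u_1=\lambda/3$, $\lambda u_i=b_iu_{i+1}+a_iu_i+c_iu_{i-1}$ ($1\le i\le D-1$); $k_i=\frac{b_0\cdots b_{i-1}}{c_1\cdots c_i}$; $v_i=k_iu_i$; $B_i=v_i(A)$. For $0\le h,i,j\le D$, $p^h_{i,j}$ denotes the $(h,j)$-entry of $B_i$. -}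

module Defs where

open import Data.Nat as ℕ using (ℕ; zero; suc; _∸_)
open import Data.Fin using (Fin; toℕ)
open import Data.List using (List; []; _∷_)
open import Data.Integer using (+_)
open import Data.Rational using (_/_; ℚ; 0ℚ; 1ℚ; _+_; _*_; _-_; 1/_; _≟_; ≢-nonZero)
open import Relation.Nullary using (yes; no)

nℚ : ℕ → ℚ
nℚ n = (+ n) / 1

-- total division (x / 0 := 0); only ever used with nonzero divisors below
inv : ℚ → ℚ
inv q with q ≟ 0ℚ
... | yes _ = 0ℚ
... | no q≢0 = 1/_ q {{≢-nonZero q≢0}}

_÷'_ : ℚ → ℚ → ℚ
x ÷' y = x * inv y

cc : ℕ → ℕ → ℚ
cc D i = (nℚ 3 * nℚ (D ∸ i ℕ.+ 1) * nℚ i * nℚ (D ℕ.+ i ℕ.+ 1))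
         ÷' (nℚ D * nℚ (D ℕ.+ 2) * nℚ (2 ℕ.* i ℕ.+ 1))

aa : ℕ → ℕ → ℚ
aa D i = (nℚ 3 * nℚ i * nℚ (i ℕ.+ 1)) ÷' (nℚ D * nℚ (D ℕ.+ 2))

bb : ℕ → ℕ → ℚ
bb D i = (nℚ 3 * nℚ (D ∸ i) * nℚ (i ℕ.+ 1) * nℚ (D ℕ.+ i ℕ.+ 2))
         ÷' (nℚ D * nℚ (D ℕ.+ 2) * nℚ (2 ℕ.* i ℕ.+ 1))

-- polynomials over ℚ in the variable λ, as coefficient lists (constant term first)
Poly : Set
Poly = List ℚ

padd : Poly → Poly → Poly
padd [] q = q
padd (x ∷ p) [] = x ∷ p
padd (x ∷ p) (y ∷ q) = (x + y) ∷ padd p q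

pscale : ℚ → Poly → Poly
pscale c [] = []
pscale c (x ∷ p) = (c * x) ∷ pscale c p

pshift : Poly → Poly
pshift p = 0ℚ ∷ p

u : ℕ → ℕ → Poly
u D zero = 1ℚ ∷ []
u D (suc zero) = 0ℚ ∷ inv (nℚ 3) ∷ []
u D (suc (suc n)) =
  pscale (inv (bb D (suc n)))
    (padd (pshift (u D (suc n)))
      (padd (pscale (0ℚ - aa D (suc n)) (u D (suc n)))
            (pscale (0ℚ - cc D (suc n)) (u D n))))

prodTo : ℕ → (ℕ → ℚ) → ℚ
prodTo zero f = 1ℚ
prodTo (suc n) f = prodTo n f * f n

k : ℕ → ℕ → ℚ
k D i = prodTo i (bb D) ÷' prodTo i (λ m → cc D (suc m))

v : ℕ → ℕ → Poly
v D i = pscale (k D i) (u D i)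

Mat : ℕ → Set
Mat D = Fin (suc D) → Fin (suc D) → ℚ

sumFin : ∀ {n} → (Fin n → ℚ) → ℚ
sumFin {zero} f = 0ℚ
sumFin {suc n} f = f Fin.zero + sumFin (λ x → f (Fin.suc x))

_⊗_ : ∀ {D} → Mat D → Mat D → Mat D
(M ⊗ N) r s = sumFin (λ t → M r t * N t s)

madd : ∀ {D} → Mat D → Mat D → Mat D
madd M N r s = M r s + N r s

idM : ∀ {D} → Mat D
idM r s with toℕ r ℕ.≟ toℕ s
... | yes _ = 1ℚ
... | no _ = 0ℚ

zeroM : ∀ {D} → Mat D
zeroM r s = 0ℚ

Amat : (D : ℕ) → Mat D
Amat D r s with toℕ r | toℕ s
... | i | j with i ℕ.≟ j
...   | yes _ = aa D i
...   | no _ with suc i ℕ.≟ j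
...     | yes _ = bb D i
...     | no _ with i ℕ.≟ suc j
...       | yes _ = cc D i
...       | no _ = 0ℚ

evalM : ∀ {D} → Poly → Mat D → Mat D
evalM [] M = zeroM
evalM (x ∷ p) M = madd (λ r s → x * idM r s) (M ⊗ evalM p M)

B : (D : ℕ) → ℕ → Mat D
B D i = evalM (v D i) (Amat D)

p : (D : ℕ) → (h i j : Fin (suc D)) → ℚ
p D h i j = B D (toℕ i) h j

{-# OPTIONS --safe #-}
-- Since the recurrence for u_i is read off the columns of the tridiagonal matrix A,
-- u_i(A) maps the unit vector e_0 to e_i / k_i; hence B_j e_0 = e_j and
-- p^h_{ij} = (B_i B_j)_{h0}, which is symmetric in i and j because polynomials in A
-- commute. The balance condition k_{i+1} c_{i+1} = k_i b_i says that diag(k) A is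
-- symmetric, and this survives for every polynomial in A: k_h (B_i)_{hj} = k_j (B_i)_{jh}.
-- Combined with the first symmetry this gives the other two identities.
module Submission where

open import Defs
open import Data.Nat using (ℕ; suc; NonZero)
open import Data.Fin using (Fin; toℕ)
open import Data.Product using (_×_)
open import Data.Rational using (_*_)
open import Relation.Binary.PropositionalEquality using (_≡_)

open import Data.Nat as ℕ using (zero; _≤_; _<_; _∸_; s≤s)
import Data.Nat.Properties as ℕP
open import Data.Fin as Fin using (fromℕ<)
import Data.Fin.Properties as FinP
open import Data.List using ([]; _∷_)
open import Data.Product using (_,_)
open import Data.Rational as ℚ using (ℚ; 0ℚ; 1ℚ; _+_; _-_; 1/_)
import Data.Rational.Properties as ℚP
open import Data.Rational.Solver using (module +-*-Solver)
open +-*-Solver using (solve; _:+_; _:*_; _:-_; _:=_; con)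
open import Data.Empty using (⊥-elim; ⊥-elim-irr)
open import Function using (_∘_)
open import Relation.Nullary using (yes; no)
open import Relation.Binary.PropositionalEquality
  using (_≢_; refl; sym; trans; cong; cong₂; subst; module ≡-Reasoning)
open import Algebra.Bundles using (CommutativeRing)
open import Algebra.Properties.Semiring.Sum (CommutativeRing.semiring ℚP.+-*-commutativeRing)
  using (sum; ∑-distrib-+; ∑-comm; *-distribˡ-sum)

open ≡-Reasoning

inv≡1/ : ∀ q .{{_ : ℚ.NonZero q}} → inv q ≡ 1/ q
inv≡1/ q {{q≢0}} with q ℚ.≟ 0ℚ
... | yes refl = ⊥-elim-irr (ℕ.NonZero.nonZero q≢0)
... | no _ = refl

inv-inverseˡ : ∀ q .{{_ : ℚ.NonZero q}} → inv q * q ≡ 1ℚ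
inv-inverseˡ q = trans (cong (_* q) (inv≡1/ q)) (ℚP.*-inverseˡ q)

inv-inverseʳ : ∀ q .{{_ : ℚ.NonZero q}} → q * inv q ≡ 1ℚ
inv-inverseʳ q = trans (cong (q *_) (inv≡1/ q)) (ℚP.*-inverseʳ q)

x*q≡y⇒x≡y*inv[q] : ∀ {x y} q .{{_ : ℚ.NonZero q}} → x * q ≡ y → x ≡ y * inv q
x*q≡y⇒x≡y*inv[q] {x} {y} q xq≡y = begin
  x                ≡⟨ sym (ℚP.*-identityʳ x) ⟩
  x * 1ℚ           ≡⟨ cong (x *_) (sym (inv-inverseʳ q)) ⟩
  x * (q * inv q)  ≡⟨ sym (ℚP.*-assoc x q (inv q)) ⟩
  (x * q) * inv q  ≡⟨ cong (_* inv q) xq≡y ⟩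
  y * inv q        ∎

inv-*-cancelʳ : ∀ p q .{{_ : ℚ.NonZero p}} .{{_ : ℚ.NonZero (p * q)}} →
                inv (p * q) * q ≡ inv p
inv-*-cancelʳ p q = trans (x*q≡y⇒x≡y*inv[q] p (begin
  inv (p * q) * q * p    ≡⟨ solve 3 (λ i q p → i :* q :* p := i :* (p :* q)) refl (inv (p * q)) q p ⟩
  inv (p * q) * (p * q)  ≡⟨ inv-inverseˡ (p * q) ⟩
  1ℚ                     ∎)) (ℚP.*-identityˡ (inv p))

inv-*-swap : ∀ x y b c .{{_ : ℚ.NonZero x}} .{{_ : ℚ.NonZero y}} →
             y * c ≡ x * b → inv y * b ≡ inv x * c
inv-*-swap x y b c yc≡xb = begin
  inv y * b                ≡⟨ sym (ℚP.*-identityʳ (inv y * b)) ⟩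
  inv y * b * 1ℚ           ≡⟨ cong (inv y * b *_) (sym (inv-inverseˡ x)) ⟩
  inv y * b * (inv x * x)  ≡⟨ solve 4 (λ iy b ix x → iy :* b :* (ix :* x) := ix :* iy :* (x :* b)) refl (inv y) b (inv x) x ⟩
  inv x * inv y * (x * b)  ≡⟨ cong (inv x * inv y *_) (sym yc≡xb) ⟩
  inv x * inv y * (y * c)  ≡⟨ solve 4 (λ ix iy y c → ix :* iy :* (y :* c) := ix :* c :* (iy :* y)) refl (inv x) (inv y) y c ⟩
  inv x * c * (inv y * y)  ≡⟨ cong (inv x * c *_) (inv-inverseˡ y) ⟩
  inv x * c * 1ℚ           ≡⟨ ℚP.*-identityʳ (inv x * c) ⟩
  inv x * c                ∎

inv-pos : ∀ {q} → 0ℚ ℚ.< q → 0ℚ ℚ.< inv q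
inv-pos {q} q>0 = subst (0ℚ ℚ.<_) (sym (inv≡1/ q {{ℚ.>-nonZero q>0}}))
                        (ℚP.positive⁻¹ _ {{ℚP.1/pos⇒pos q {{ℚ.positive q>0}}}})

*-pos : ∀ {p q} → 0ℚ ℚ.< p → 0ℚ ℚ.< q → 0ℚ ℚ.< p * q
*-pos {p} {q} p>0 q>0 = ℚP.positive⁻¹ _ {{ℚP.pos*pos⇒pos p {{ℚ.positive p>0}} q {{ℚ.positive q>0}}}}

nℚ-pos : ∀ n .{{_ : ℕ.NonZero n}} → 0ℚ ℚ.< nℚ n
nℚ-pos n = ℚP.positive⁻¹ _ {{ℚP.normalize-pos n 1}}

nonZero-+suc : ∀ m n → ℕ.NonZero (m ℕ.+ suc n)
nonZero-+suc m n = subst ℕ.NonZero (sym (ℕP.+-suc m n)) _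

sumFin≡sum : ∀ {n} (f : Fin n → ℚ) → sumFin f ≡ sum f
sumFin≡sum {zero} f = refl
sumFin≡sum {suc n} f = cong (f Fin.zero +_) (sumFin≡sum (f ∘ Fin.suc))

sumFin-cong : ∀ {n} {f g : Fin n → ℚ} → (∀ t → f t ≡ g t) → sumFin f ≡ sumFin g
sumFin-cong {zero} f≗g = refl
sumFin-cong {suc n} f≗g = cong₂ _+_ (f≗g Fin.zero) (sumFin-cong (f≗g ∘ Fin.suc))

sumFin-zero : ∀ n → sumFin {n} (λ _ → 0ℚ) ≡ 0ℚ
sumFin-zero zero = refl
sumFin-zero (suc n) = cong (0ℚ +_) (sumFin-zero n)

sumFin-distrib-+ : ∀ {n} (f g : Fin n → ℚ) → sumFin (λ t → f t + g t) ≡ sumFin f + sumFin g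
sumFin-distrib-+ f g = begin
  sumFin (λ t → f t + g t)  ≡⟨ sumFin≡sum (λ t → f t + g t) ⟩
  sum (λ t → f t + g t)     ≡⟨ ∑-distrib-+ f g ⟩
  sum f + sum g             ≡⟨ sym (cong₂ _+_ (sumFin≡sum f) (sumFin≡sum g)) ⟩
  sumFin f + sumFin g       ∎

*-distribˡ-sumFin : ∀ {n} x (f : Fin n → ℚ) → x * sumFin f ≡ sumFin (λ t → x * f t)
*-distribˡ-sumFin x f = begin
  x * sumFin f            ≡⟨ cong (x *_) (sumFin≡sum f) ⟩
  x * sum f               ≡⟨ *-distribˡ-sum x f ⟩
  sum (λ t → x * f t)     ≡⟨ sym (sumFin≡sum (λ t → x * f t)) ⟩
  sumFin (λ t → x * f t)  ∎

sumFin-comm : ∀ {m n} (f : Fin m → Fin n → ℚ) →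
              sumFin (λ s → sumFin (f s)) ≡ sumFin (λ t → sumFin (λ s → f s t))
sumFin-comm f = begin
  sumFin (λ s → sumFin (f s))          ≡⟨ trans (sumFin-cong (sumFin≡sum ∘ f)) (sumFin≡sum (λ s → sum (f s))) ⟩
  sum (λ s → sum (f s))                ≡⟨ ∑-comm f ⟩
  sum (λ t → sum (λ s → f s t))        ≡⟨ sym (trans (sumFin-cong (λ t → sumFin≡sum (λ s → f s t)))
                                                     (sumFin≡sum (λ t → sum (λ s → f s t)))) ⟩
  sumFin (λ t → sumFin (λ s → f s t))  ∎

δ : ℕ → ℕ → ℚ
δ zero zero = 1ℚ
δ zero (suc n) = 0ℚ
δ (suc m) zero = 0ℚ
δ (suc m) (suc n) = δ m n

δ-refl : ∀ m → δ m m ≡ 1ℚ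
δ-refl zero = refl
δ-refl (suc m) = δ-refl m

δ-≢ : ∀ {m n} → m ≢ n → δ m n ≡ 0ℚ
δ-≢ {zero} {zero} m≢n = ⊥-elim (m≢n refl)
δ-≢ {zero} {suc n} m≢n = refl
δ-≢ {suc m} {zero} m≢n = refl
δ-≢ {suc m} {suc n} m≢n = δ-≢ (m≢n ∘ cong suc)

δ-sym : ∀ m n → δ m n ≡ δ n m
δ-sym zero zero = refl
δ-sym zero (suc n) = refl
δ-sym (suc m) zero = refl
δ-sym (suc m) (suc n) = δ-sym m n

δ-elim : ∀ {x y} m n → (m ≡ n → x ≡ y) → x * δ m n ≡ y * δ m n
δ-elim zero zero x≡y = cong (_* 1ℚ) (x≡y refl)
δ-elim {x} {y} zero (suc n) _ = trans (ℚP.*-zeroʳ x) (sym (ℚP.*-zeroʳ y))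
δ-elim {x} {y} (suc m) zero _ = trans (ℚP.*-zeroʳ x) (sym (ℚP.*-zeroʳ y))
δ-elim (suc m) (suc n) x≡y = δ-elim m n (x≡y ∘ cong suc)

idM≡δ : ∀ {D} (r s : Fin (suc D)) → idM r s ≡ δ (toℕ r) (toℕ s)
idM≡δ r s with toℕ r ℕ.≟ toℕ s
... | yes r≡s = sym (trans (cong (δ (toℕ r)) (sym r≡s)) (δ-refl (toℕ r)))
... | no r≢s = sym (δ-≢ r≢s)

sumFin-δ : ∀ {n} (f : Fin n → ℚ) {j} (j<n : j < n) →
           sumFin (λ t → f t * δ (toℕ t) j) ≡ f (fromℕ< j<n)
sumFin-δ {suc n} f {zero} _ = begin
  f Fin.zero * 1ℚ + sumFin (λ t → f (Fin.suc t) * 0ℚ)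
    ≡⟨ cong₂ _+_ (ℚP.*-identityʳ (f Fin.zero)) (trans (sumFin-cong (ℚP.*-zeroʳ ∘ f ∘ Fin.suc)) (sumFin-zero n)) ⟩
  f Fin.zero + 0ℚ  ≡⟨ ℚP.+-identityʳ (f Fin.zero) ⟩
  f Fin.zero       ∎
sumFin-δ {suc n} f {suc j} j<n = begin
  f Fin.zero * 0ℚ + sumFin (λ t → f (Fin.suc t) * δ (toℕ t) j)
    ≡⟨ cong₂ _+_ (ℚP.*-zeroʳ (f Fin.zero)) (sumFin-δ (f ∘ Fin.suc) (ℕ.s<s⁻¹ j<n)) ⟩
  0ℚ + f (fromℕ< j<n)  ≡⟨ ℚP.+-identityˡ (f (fromℕ< j<n)) ⟩
  f (fromℕ< j<n)       ∎

sumFin-δ-toℕ : ∀ {n} (f : Fin n → ℚ) (s : Fin n) → sumFin (λ t → f t * δ (toℕ t) (toℕ s)) ≡ f s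
sumFin-δ-toℕ f s = trans (sumFin-δ f (FinP.toℕ<n s)) (cong f (FinP.fromℕ<-toℕ s (FinP.toℕ<n s)))

module _ {D : ℕ} where

  infix 4 _≈_

  _≈_ : Mat D → Mat D → Set
  M ≈ N = ∀ r s → M r s ≡ N r s

  scal : ℚ → Mat D → Mat D
  scal x M r s = x * M r s

  ⊗-congʳ : ∀ M {N N′} → N ≈ N′ → M ⊗ N ≈ M ⊗ N′
  ⊗-congʳ M N≈N′ r s = sumFin-cong (λ t → cong (M r t *_) (N≈N′ t s))

  ⊗-congˡ : ∀ {M M′} N → M ≈ M′ → M ⊗ N ≈ M′ ⊗ N
  ⊗-congˡ N M≈M′ r s = sumFin-cong (λ t → cong (_* N t s) (M≈M′ r t))

  ⊗-assoc : ∀ M N P → (M ⊗ N) ⊗ P ≈ M ⊗ (N ⊗ P)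
  ⊗-assoc M N P r s = begin
    sumFin (λ u → sumFin (λ t → M r t * N t u) * P u s)
      ≡⟨ sumFin-cong (λ u → trans (ℚP.*-comm _ (P u s)) (*-distribˡ-sumFin (P u s) (λ t → M r t * N t u))) ⟩
    sumFin (λ u → sumFin (λ t → P u s * (M r t * N t u)))
      ≡⟨ sumFin-comm (λ u t → P u s * (M r t * N t u)) ⟩
    sumFin (λ t → sumFin (λ u → P u s * (M r t * N t u)))
      ≡⟨ sumFin-cong (λ t → trans
           (sumFin-cong (λ u → solve 3 (λ p m n → p :* (m :* n) := m :* (n :* p)) refl (P u s) (M r t) (N t u)))
           (sym (*-distribˡ-sumFin (M r t) (λ u → N t u * P u s)))) ⟩
    sumFin (λ t → M r t * sumFin (λ u → N t u * P u s))  ∎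

  ⊗-distribˡ-madd : ∀ M N P → M ⊗ madd N P ≈ madd (M ⊗ N) (M ⊗ P)
  ⊗-distribˡ-madd M N P r s =
    trans (sumFin-cong (λ t → ℚP.*-distribˡ-+ (M r t) (N t s) (P t s)))
          (sumFin-distrib-+ (λ t → M r t * N t s) (λ t → M r t * P t s))

  ⊗-distribʳ-madd : ∀ M N P → madd M N ⊗ P ≈ madd (M ⊗ P) (N ⊗ P)
  ⊗-distribʳ-madd M N P r s =
    trans (sumFin-cong (λ t → ℚP.*-distribʳ-+ (P t s) (M r t) (N r t)))
          (sumFin-distrib-+ (λ t → M r t * P t s) (λ t → N r t * P t s))

  ⊗-scalʳ : ∀ x M N → M ⊗ scal x N ≈ scal x (M ⊗ N)
  ⊗-scalʳ x M N r s =
    trans (sumFin-cong (λ t → solve 3 (λ m x n → m :* (x :* n) := x :* (m :* n)) refl (M r t) x (N t s)))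
          (sym (*-distribˡ-sumFin x (λ t → M r t * N t s)))

  ⊗-scalˡ : ∀ x M N → scal x M ⊗ N ≈ scal x (M ⊗ N)
  ⊗-scalˡ x M N r s =
    trans (sumFin-cong (λ t → ℚP.*-assoc x (M r t) (N t s)))
          (sym (*-distribˡ-sumFin x (λ t → M r t * N t s)))

  ⊗-identityʳ : ∀ M → M ⊗ idM ≈ M
  ⊗-identityʳ M r s =
    trans (sumFin-cong (λ t → cong (M r t *_) (idM≡δ t s))) (sumFin-δ-toℕ (M r) s)

  ⊗-identityˡ : ∀ M → idM ⊗ M ≈ M
  ⊗-identityˡ M r s =
    trans (sumFin-cong (λ t → trans (ℚP.*-comm (idM r t) (M t s))
                                     (cong (M t s *_) (trans (idM≡δ r t) (δ-sym (toℕ r) (toℕ t))))))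
          (sumFin-δ-toℕ (λ t → M t s) r)

  ⊗-zeroʳ : ∀ M → M ⊗ zeroM ≈ zeroM
  ⊗-zeroʳ M r s = trans (sumFin-cong (λ t → ℚP.*-zeroʳ (M r t))) (sumFin-zero (suc D))

  ⊗-zeroˡ : ∀ M → zeroM ⊗ M ≈ zeroM
  ⊗-zeroˡ M r s = trans (sumFin-cong (λ t → ℚP.*-zeroˡ (M t s))) (sumFin-zero (suc D))

  evalM-padd : ∀ p q A → evalM (padd p q) A ≈ madd (evalM p A) (evalM q A)
  evalM-padd [] q A r s = sym (ℚP.+-identityˡ (evalM q A r s))
  evalM-padd (x ∷ p) [] A r s = sym (ℚP.+-identityʳ (evalM (x ∷ p) A r s))
  evalM-padd (x ∷ p) (y ∷ q) A r s = begin
    (x + y) * idM r s + (A ⊗ evalM (padd p q) A) r s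
      ≡⟨ cong ((x + y) * idM r s +_)
              (trans (⊗-congʳ A (evalM-padd p q A) r s) (⊗-distribˡ-madd A (evalM p A) (evalM q A) r s)) ⟩
    (x + y) * idM r s + ((A ⊗ evalM p A) r s + (A ⊗ evalM q A) r s)
      ≡⟨ solve 5 (λ x y i a b → (x :+ y) :* i :+ (a :+ b) := (x :* i :+ a) :+ (y :* i :+ b))
               refl x y (idM r s) ((A ⊗ evalM p A) r s) ((A ⊗ evalM q A) r s) ⟩
    (x * idM r s + (A ⊗ evalM p A) r s) + (y * idM r s + (A ⊗ evalM q A) r s)  ∎

  evalM-pscale : ∀ x p A → evalM (pscale x p) A ≈ scal x (evalM p A)
  evalM-pscale x [] A r s = sym (ℚP.*-zeroʳ x)
  evalM-pscale x (y ∷ p) A r s = begin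
    x * y * idM r s + (A ⊗ evalM (pscale x p) A) r s
      ≡⟨ cong (x * y * idM r s +_) (trans (⊗-congʳ A (evalM-pscale x p A) r s) (⊗-scalʳ x A (evalM p A) r s)) ⟩
    x * y * idM r s + x * (A ⊗ evalM p A) r s
      ≡⟨ solve 4 (λ x y i a → x :* y :* i :+ x :* a := x :* (y :* i :+ a)) refl x y (idM r s) ((A ⊗ evalM p A) r s) ⟩
    x * (y * idM r s + (A ⊗ evalM p A) r s)  ∎

  evalM-pshift : ∀ p A → evalM (pshift p) A ≈ A ⊗ evalM p A
  evalM-pshift p A r s =
    trans (cong (_+ (A ⊗ evalM p A) r s) (ℚP.*-zeroˡ (idM r s))) (ℚP.+-identityˡ ((A ⊗ evalM p A) r s))

  evalM-threeTerm : ∀ x y z p q A →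
    evalM (pscale x (padd (pshift p) (padd (pscale y p) (pscale z q)))) A ≈
    scal x (madd (A ⊗ evalM p A) (madd (scal y (evalM p A)) (scal z (evalM q A))))
  evalM-threeTerm x y z p q A r s = begin
    evalM (pscale x (padd (pshift p) (padd (pscale y p) (pscale z q)))) A r s
      ≡⟨ evalM-pscale x (padd (pshift p) (padd (pscale y p) (pscale z q))) A r s ⟩
    x * evalM (padd (pshift p) (padd (pscale y p) (pscale z q))) A r s
      ≡⟨ cong (x *_) (evalM-padd (pshift p) (padd (pscale y p) (pscale z q)) A r s) ⟩
    x * (evalM (pshift p) A r s + evalM (padd (pscale y p) (pscale z q)) A r s)
      ≡⟨ cong (λ e → x * (evalM (pshift p) A r s + e)) (evalM-padd (pscale y p) (pscale z q) A r s) ⟩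
    x * (evalM (pshift p) A r s + (evalM (pscale y p) A r s + evalM (pscale z q) A r s))
      ≡⟨ cong (x *_) (cong₂ _+_ (evalM-pshift p A r s)
                                (cong₂ _+_ (evalM-pscale y p A r s) (evalM-pscale z q A r s))) ⟩
    x * ((A ⊗ evalM p A) r s + (y * evalM p A r s + z * evalM q A r s))  ∎

  ⊗-column : ∀ M N w {c j} (j<1+D : j < suc D) → (∀ s → N s c ≡ w * δ (toℕ s) j) →
             ∀ t → (M ⊗ N) t c ≡ w * M t (fromℕ< j<1+D)
  ⊗-column M N w {c} {j} j<1+D N-col t = begin
    sumFin (λ s → M t s * N s c)              ≡⟨ sumFin-cong (λ s → cong (M t s *_) (N-col s)) ⟩
    sumFin (λ s → M t s * (w * δ (toℕ s) j))  ≡⟨ sumFin-cong (λ s → solve 3 (λ m w d → m :* (w :* d) := w :* (m :* d))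
                                                                        refl (M t s) w (δ (toℕ s) j)) ⟩
    sumFin (λ s → w * (M t s * δ (toℕ s) j))  ≡⟨ sym (*-distribˡ-sumFin w (λ s → M t s * δ (toℕ s) j)) ⟩
    w * sumFin (λ s → M t s * δ (toℕ s) j)    ≡⟨ cong (w *_) (sumFin-δ (M t) j<1+D) ⟩
    w * M t (fromℕ< j<1+D)                    ∎

  evalM-commutes : ∀ p A E → A ⊗ E ≈ E ⊗ A → evalM p A ⊗ E ≈ E ⊗ evalM p A
  evalM-commutes [] A E AE≈EA r s = trans (⊗-zeroˡ E r s) (sym (⊗-zeroʳ E r s))
  evalM-commutes (x ∷ p) A E AE≈EA r s = begin
    (madd (scal x idM) (A ⊗ P) ⊗ E) r s
      ≡⟨ ⊗-distribʳ-madd (scal x idM) (A ⊗ P) E r s ⟩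
    (scal x idM ⊗ E) r s + ((A ⊗ P) ⊗ E) r s
      ≡⟨ cong₂ _+_ scalar-part polynomial-part ⟩
    (E ⊗ scal x idM) r s + (E ⊗ (A ⊗ P)) r s
      ≡⟨ sym (⊗-distribˡ-madd E (scal x idM) (A ⊗ P) r s) ⟩
    (E ⊗ madd (scal x idM) (A ⊗ P)) r s  ∎
    where
    P = evalM p A

    scalar-part : (scal x idM ⊗ E) r s ≡ (E ⊗ scal x idM) r s
    scalar-part = begin
      (scal x idM ⊗ E) r s  ≡⟨ ⊗-scalˡ x idM E r s ⟩
      x * (idM ⊗ E) r s     ≡⟨ cong (x *_) (trans (⊗-identityˡ E r s) (sym (⊗-identityʳ E r s))) ⟩
      x * (E ⊗ idM) r s     ≡⟨ sym (⊗-scalʳ x E idM r s) ⟩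
      (E ⊗ scal x idM) r s  ∎

    polynomial-part : ((A ⊗ P) ⊗ E) r s ≡ (E ⊗ (A ⊗ P)) r s
    polynomial-part = begin
      ((A ⊗ P) ⊗ E) r s  ≡⟨ ⊗-assoc A P E r s ⟩
      (A ⊗ (P ⊗ E)) r s  ≡⟨ ⊗-congʳ A (evalM-commutes p A E AE≈EA) r s ⟩
      (A ⊗ (E ⊗ P)) r s  ≡⟨ sym (⊗-assoc A E P r s) ⟩
      ((A ⊗ E) ⊗ P) r s  ≡⟨ ⊗-congˡ P AE≈EA r s ⟩
      ((E ⊗ A) ⊗ P) r s  ≡⟨ ⊗-assoc E A P r s ⟩
      (E ⊗ (A ⊗ P)) r s  ∎

  evalM-comm : ∀ p q A → evalM p A ⊗ evalM q A ≈ evalM q A ⊗ evalM p A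
  evalM-comm p q A = evalM-commutes p A (evalM q A) (λ r s → sym (evalM-commutes q A A (λ _ _ → refl) r s))

  WeightedSymmetric : (Fin (suc D) → ℚ) → Mat D → Set
  WeightedSymmetric w M = ∀ r s → w r * M r s ≡ w s * M s r

  module _ {w : Fin (suc D) → ℚ} where

    weightedSymmetric-zeroM : WeightedSymmetric w zeroM
    weightedSymmetric-zeroM r s = trans (ℚP.*-zeroʳ (w r)) (sym (ℚP.*-zeroʳ (w s)))

    weightedSymmetric-idM : WeightedSymmetric w idM
    weightedSymmetric-idM r s = begin
      w r * idM r s                ≡⟨ cong (w r *_) (idM≡δ r s) ⟩
      w r * δ (toℕ r) (toℕ s)      ≡⟨ δ-elim (toℕ r) (toℕ s) (cong w ∘ FinP.toℕ-injective) ⟩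
      w s * δ (toℕ r) (toℕ s)      ≡⟨ cong (w s *_) (trans (δ-sym (toℕ r) (toℕ s)) (sym (idM≡δ s r))) ⟩
      w s * idM s r                ∎

    weightedSymmetric-scal : ∀ x {M} → WeightedSymmetric w M → WeightedSymmetric w (scal x M)
    weightedSymmetric-scal x {M} wsM r s = begin
      w r * (x * M r s)  ≡⟨ solve 3 (λ w x m → w :* (x :* m) := x :* (w :* m)) refl (w r) x (M r s) ⟩
      x * (w r * M r s)  ≡⟨ cong (x *_) (wsM r s) ⟩
      x * (w s * M s r)  ≡⟨ solve 3 (λ x w m → x :* (w :* m) := w :* (x :* m)) refl x (w s) (M s r) ⟩
      w s * (x * M s r)  ∎

    weightedSymmetric-madd : ∀ {M N} → WeightedSymmetric w M → WeightedSymmetric w N →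
                             WeightedSymmetric w (madd M N)
    weightedSymmetric-madd {M} {N} wsM wsN r s = begin
      w r * (M r s + N r s)        ≡⟨ ℚP.*-distribˡ-+ (w r) (M r s) (N r s) ⟩
      w r * M r s + w r * N r s    ≡⟨ cong₂ _+_ (wsM r s) (wsN r s) ⟩
      w s * M s r + w s * N s r    ≡⟨ sym (ℚP.*-distribˡ-+ (w s) (M s r) (N s r)) ⟩
      w s * (M s r + N s r)        ∎

    -- Weighted transposition reverses products, hence the commutation hypothesis.
    weightedSymmetric-⊗ : ∀ {M N} → WeightedSymmetric w M → WeightedSymmetric w N →
                          M ⊗ N ≈ N ⊗ M → WeightedSymmetric w (M ⊗ N)
    weightedSymmetric-⊗ {M} {N} wsM wsN MN≈NM r s = begin
      w r * (M ⊗ N) r s                    ≡⟨ *-distribˡ-sumFin (w r) (λ t → M r t * N t s) ⟩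
      sumFin (λ t → w r * (M r t * N t s)) ≡⟨ sumFin-cong swap ⟩
      sumFin (λ t → w s * (N s t * M t r)) ≡⟨ sym (*-distribˡ-sumFin (w s) (λ t → N s t * M t r)) ⟩
      w s * (N ⊗ M) s r                    ≡⟨ cong (w s *_) (sym (MN≈NM s r)) ⟩
      w s * (M ⊗ N) s r                    ∎
      where
      swap : ∀ t → w r * (M r t * N t s) ≡ w s * (N s t * M t r)
      swap t = begin
        w r * (M r t * N t s)  ≡⟨ sym (ℚP.*-assoc (w r) (M r t) (N t s)) ⟩
        w r * M r t * N t s    ≡⟨ cong (_* N t s) (wsM r t) ⟩
        w t * M t r * N t s    ≡⟨ solve 3 (λ w m n → w :* m :* n := m :* (w :* n)) refl (w t) (M t r) (N t s) ⟩
        M t r * (w t * N t s)  ≡⟨ cong (M t r *_) (wsN t s) ⟩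
        M t r * (w s * N s t)  ≡⟨ solve 3 (λ m w n → m :* (w :* n) := w :* (n :* m)) refl (M t r) (w s) (N s t) ⟩
        w s * (N s t * M t r)  ∎

    weightedSymmetric-evalM : ∀ p {A} → WeightedSymmetric w A → WeightedSymmetric w (evalM p A)
    weightedSymmetric-evalM [] wsA = weightedSymmetric-zeroM
    weightedSymmetric-evalM (x ∷ p) {A} wsA =
      weightedSymmetric-madd (weightedSymmetric-scal x weightedSymmetric-idM)
        (weightedSymmetric-⊗ wsA (weightedSymmetric-evalM p wsA)
           (λ r s → sym (evalM-commutes p A A (λ _ _ → refl) r s)))

tridiag : (a b c : ℕ → ℚ) → ℕ → ℕ → ℚ
tridiag a b c i j = b i * δ (suc i) j + a i * δ i j + c i * δ i (suc j)

module _ (a b c : ℕ → ℚ) where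

  tridiag-diag : ∀ i → tridiag a b c i i ≡ a i
  tridiag-diag i
    rewrite δ-≢ {suc i} {i} ℕP.1+n≢n | δ-refl i | δ-≢ {i} {suc i} (ℕP.1+n≢n ∘ sym)
    = solve 3 (λ b a c → b :* con 0ℚ :+ a :* con 1ℚ :+ c :* con 0ℚ := a) refl (b i) (a i) (c i)

  tridiag-super : ∀ i → tridiag a b c i (suc i) ≡ b i
  tridiag-super i
    rewrite δ-refl i | δ-≢ {i} {suc i} (ℕP.1+n≢n ∘ sym) | δ-≢ {i} {suc (suc i)} (ℕP.m≢1+n+m i {1})
    = solve 3 (λ b a c → b :* con 1ℚ :+ a :* con 0ℚ :+ c :* con 0ℚ := b) refl (b i) (a i) (c i)

  tridiag-sub : ∀ j → tridiag a b c (suc j) j ≡ c (suc j)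
  tridiag-sub j
    rewrite δ-≢ {suc (suc j)} {j} (ℕP.m≢1+n+m j {1} ∘ sym) | δ-≢ {suc j} {j} ℕP.1+n≢n | δ-refl j
    = solve 3 (λ b a c → b :* con 0ℚ :+ a :* con 0ℚ :+ c :* con 1ℚ := c) refl (b (suc j)) (a (suc j)) (c (suc j))

  tridiag-off : ∀ {i j} → suc i ≢ j → i ≢ j → i ≢ suc j → tridiag a b c i j ≡ 0ℚ
  tridiag-off {i} {j} 1+i≢j i≢j i≢1+j
    rewrite δ-≢ 1+i≢j | δ-≢ i≢j | δ-≢ i≢1+j
    = solve 3 (λ b a c → b :* con 0ℚ :+ a :* con 0ℚ :+ c :* con 0ℚ := con 0ℚ) refl (b i) (a i) (c i)

  tridiag-column₀ : ∀ i → tridiag a b c i 0 ≡ a 0 * δ i 0 + c 1 * δ i 1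
  tridiag-column₀ i = begin
    b i * 0ℚ + a i * δ i 0 + c i * δ i 1  ≡⟨ cong (λ x → x + a i * δ i 0 + c i * δ i 1) (ℚP.*-zeroʳ (b i)) ⟩
    0ℚ + a i * δ i 0 + c i * δ i 1        ≡⟨ cong₂ _+_ (trans (ℚP.+-identityˡ _) (δ-elim i 0 (cong a)))
                                                      (δ-elim i 1 (cong c)) ⟩
    a 0 * δ i 0 + c 1 * δ i 1             ∎

  tridiag-column : ∀ i j → tridiag a b c i (suc j) ≡
                   b j * δ i j + a (suc j) * δ i (suc j) + c (suc (suc j)) * δ i (suc (suc j))
  tridiag-column i j =
    cong₂ _+_ (cong₂ _+_ (δ-elim i j (cong b)) (δ-elim i (suc j) (cong a))) (δ-elim i (suc (suc j)) (cong c))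

  tridiag-weightedSymmetric :
    ∀ (w : ℕ → ℚ) n → (∀ i → i < n → w (suc i) * c (suc i) ≡ w i * b i) →
    ∀ i j → i ≤ n → j ≤ n → w i * tridiag a b c i j ≡ w j * tridiag a b c j i
  tridiag-weightedSymmetric w n balanced i j i≤n j≤n = begin
    w i * tridiag a b c i j
      ≡⟨ solve 7 (λ w b a c x y z → w :* (b :* x :+ a :* y :+ c :* z) := w :* b :* x :+ w :* a :* y :+ w :* c :* z)
               refl (w i) (b i) (a i) (c i) (δ (suc i) j) (δ i j) (δ i (suc j)) ⟩
    w i * b i * δ (suc i) j + w i * a i * δ i j + w i * c i * δ i (suc j)
      ≡⟨ cong₂ _+_ (cong₂ _+_ (edge i j j≤n) diagonal) (sym (edge j i i≤n)) ⟩
    w j * c j * δ j (suc i) + w j * a j * δ j i + w j * b j * δ (suc j) i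
      ≡⟨ solve 7 (λ w b a c x y z → w :* c :* z :+ w :* a :* y :+ w :* b :* x := w :* (b :* x :+ a :* y :+ c :* z))
               refl (w j) (b j) (a j) (c j) (δ (suc j) i) (δ j i) (δ j (suc i)) ⟩
    w j * tridiag a b c j i  ∎
    where
    edge : ∀ i j → j ≤ n → w i * b i * δ (suc i) j ≡ w j * c j * δ j (suc i)
    edge i j j≤n = begin
      w i * b i * δ (suc i) j  ≡⟨ cong (w i * b i *_) (δ-sym (suc i) j) ⟩
      w i * b i * δ j (suc i)  ≡⟨ δ-elim {w i * b i} {w j * c j} j (suc i) (λ { refl → sym (balanced i j≤n) }) ⟩
      w j * c j * δ j (suc i)  ∎

    diagonal : w i * a i * δ i j ≡ w j * a j * δ j i
    diagonal = trans (δ-elim {w i * a i} {w j * a j} i j (λ { refl → refl })) (cong (w j * a j *_) (δ-sym i j))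

Amat≡tridiag : ∀ D (r s : Fin (suc D)) → Amat D r s ≡ tridiag (aa D) (bb D) (cc D) (toℕ r) (toℕ s)
Amat≡tridiag D r s with toℕ r | toℕ s
... | i | j with i ℕ.≟ j
...   | yes refl = sym (tridiag-diag (aa D) (bb D) (cc D) i)
...   | no i≢j with suc i ℕ.≟ j
...     | yes refl = sym (tridiag-super (aa D) (bb D) (cc D) i)
...     | no 1+i≢j with i ℕ.≟ suc j
...       | yes refl = sym (tridiag-sub (aa D) (bb D) (cc D) j)
...       | no i≢1+j = sym (tridiag-off (aa D) (bb D) (cc D) 1+i≢j i≢j i≢1+j)

prodTo-pos : ∀ n (f : ℕ → ℚ) → (∀ m → m < n → 0ℚ ℚ.< f m) → 0ℚ ℚ.< prodTo n f
prodTo-pos zero f _ = ℚP.positive⁻¹ 1ℚ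
prodTo-pos (suc n) f f-pos = *-pos (prodTo-pos n f (λ m m<n → f-pos m (ℕP.m<n⇒m<1+n m<n))) (f-pos n ℕP.≤-refl)

threeTerm-step : ∀ β ω₀ ω₁ ω₂ b₀ b₁ a c₁ c₂ d₀ d₁ d₂ → b₁ * β ≡ 1ℚ →
                 ω₁ * b₀ ≡ ω₀ * c₁ → ω₂ * b₁ ≡ ω₁ * c₂ →
                 β * (ω₁ * (b₀ * d₀ + a * d₁ + c₂ * d₂) + ((0ℚ - a) * (ω₁ * d₁) + (0ℚ - c₁) * (ω₀ * d₀)))
                   ≡ ω₂ * d₂
threeTerm-step β ω₀ ω₁ ω₂ b₀ b₁ a c₁ c₂ d₀ d₁ d₂ b₁β≡1 balanced₀ balanced₁ = begin
  β * (ω₁ * (b₀ * d₀ + a * d₁ + c₂ * d₂) + ((0ℚ - a) * (ω₁ * d₁) + (0ℚ - c₁) * (ω₀ * d₀)))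
    ≡⟨ solve 10 (λ β ω₀ ω₁ b₀ a c₁ c₂ d₀ d₁ d₂ →
                   β :* (ω₁ :* (b₀ :* d₀ :+ a :* d₁ :+ c₂ :* d₂)
                         :+ ((con 0ℚ :- a) :* (ω₁ :* d₁) :+ (con 0ℚ :- c₁) :* (ω₀ :* d₀)))
                   := β :* d₀ :* (ω₁ :* b₀ :- ω₀ :* c₁) :+ ω₁ :* c₂ :* β :* d₂)
             refl β ω₀ ω₁ b₀ a c₁ c₂ d₀ d₁ d₂ ⟩
  β * d₀ * (ω₁ * b₀ - ω₀ * c₁) + ω₁ * c₂ * β * d₂
    ≡⟨ cong₂ (λ x y → β * d₀ * (x - ω₀ * c₁) + y * β * d₂) balanced₀ (sym balanced₁) ⟩
  β * d₀ * (ω₀ * c₁ - ω₀ * c₁) + ω₂ * b₁ * β * d₂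
    ≡⟨ solve 6 (λ β d₀ x ω₂ b₁ d₂ → β :* d₀ :* (x :- x) :+ ω₂ :* b₁ :* β :* d₂ := ω₂ :* (b₁ :* β) :* d₂)
             refl β d₀ (ω₀ * c₁) ω₂ b₁ d₂ ⟩
  ω₂ * (b₁ * β) * d₂  ≡⟨ cong (λ x → ω₂ * x * d₂) b₁β≡1 ⟩
  ω₂ * 1ℚ * d₂        ≡⟨ cong (_* d₂) (ℚP.*-identityʳ ω₂) ⟩
  ω₂ * d₂             ∎

module Parameters (D : ℕ) .{{_ : NonZero D}} where

  denominator-pos : ∀ i → 0ℚ ℚ.< nℚ D * nℚ (D ℕ.+ 2) * nℚ (2 ℕ.* i ℕ.+ 1)
  denominator-pos i =
    *-pos (*-pos (nℚ-pos D) (nℚ-pos (D ℕ.+ 2) {{nonZero-+suc D 1}}))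
          (nℚ-pos (2 ℕ.* i ℕ.+ 1) {{nonZero-+suc (2 ℕ.* i) 0}})

  bb-pos : ∀ {i} → i < D → 0ℚ ℚ.< bb D i
  bb-pos {i} i<D =
    *-pos (*-pos (*-pos (*-pos (nℚ-pos 3) (nℚ-pos (D ∸ i) {{ℕ.>-nonZero (ℕP.m<n⇒0<n∸m i<D)}}))
                        (nℚ-pos (i ℕ.+ 1) {{nonZero-+suc i 0}}))
                 (nℚ-pos (D ℕ.+ i ℕ.+ 2) {{nonZero-+suc (D ℕ.+ i) 1}}))
          (inv-pos (denominator-pos i))

  cc-pos : ∀ i → 0ℚ ℚ.< cc D (suc i)
  cc-pos i =
    *-pos (*-pos (*-pos (*-pos (nℚ-pos 3) (nℚ-pos (D ∸ suc i ℕ.+ 1) {{nonZero-+suc (D ∸ suc i) 0}}))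
                        (nℚ-pos (suc i)))
                 (nℚ-pos (D ℕ.+ suc i ℕ.+ 1) {{nonZero-+suc (D ℕ.+ suc i) 0}}))
          (inv-pos (denominator-pos (suc i)))

  prodTo-cc-pos : ∀ i → 0ℚ ℚ.< prodTo i (cc D ∘ suc)
  prodTo-cc-pos i = prodTo-pos i (cc D ∘ suc) (λ m _ → cc-pos m)

  k-pos : ∀ {i} → i ≤ D → 0ℚ ℚ.< k D i
  k-pos {i} i≤D =
    *-pos (prodTo-pos i (bb D) (λ m m<i → bb-pos (ℕP.<-≤-trans m<i i≤D))) (inv-pos (prodTo-cc-pos i))

  k-balanced : ∀ {i} → i < D → k D (suc i) * cc D (suc i) ≡ k D i * bb D i
  k-balanced {i} i<D = begin
    (Πb * b) * inv (Πc * c) * c    ≡⟨ ℚP.*-assoc (Πb * b) (inv (Πc * c)) c ⟩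
    (Πb * b) * (inv (Πc * c) * c)  ≡⟨ cong ((Πb * b) *_) (inv-*-cancelʳ Πc c {{Πc≢0}} {{Πcc≢0}}) ⟩
    (Πb * b) * inv Πc              ≡⟨ solve 3 (λ p b i → p :* b :* i := p :* i :* b) refl Πb b (inv Πc) ⟩
    Πb * inv Πc * b                ∎
    where
    Πb = prodTo i (bb D)
    Πc = prodTo i (cc D ∘ suc)
    b = bb D i
    c = cc D (suc i)
    Πc≢0 = ℚ.>-nonZero (prodTo-cc-pos i)
    Πcc≢0 = ℚ.>-nonZero (*-pos (prodTo-cc-pos i) (cc-pos i))

  aa-zero : aa D 0 ≡ 0ℚ
  aa-zero = ℚP.*-zeroˡ (inv (nℚ D * nℚ (D ℕ.+ 2)))

  bb-zero : bb D 0 ≡ nℚ 3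
  bb-zero = begin
    nℚ 3 * nℚ D * 1ℚ * nℚ (D ℕ.+ 0 ℕ.+ 2) * inv Y
      ≡⟨ cong (λ n → nℚ 3 * nℚ D * 1ℚ * nℚ (n ℕ.+ 2) * inv Y) (ℕP.+-identityʳ D) ⟩
    nℚ 3 * nℚ D * 1ℚ * nℚ (D ℕ.+ 2) * inv Y
      ≡⟨ solve 4 (λ t d x i → t :* d :* con 1ℚ :* x :* i := t :* (d :* x :* con 1ℚ :* i))
               refl (nℚ 3) (nℚ D) (nℚ (D ℕ.+ 2)) (inv Y) ⟩
    nℚ 3 * (Y * inv Y)  ≡⟨ cong (nℚ 3 *_) (inv-inverseʳ Y {{ℚ.>-nonZero (denominator-pos 0)}}) ⟩
    nℚ 3 * 1ℚ           ≡⟨ ℚP.*-identityʳ (nℚ 3) ⟩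
    nℚ 3                ∎
    where Y = nℚ D * nℚ (D ℕ.+ 2) * 1ℚ

  k≢0 : ∀ {i} → i ≤ D → ℚ.NonZero (k D i)
  k≢0 i≤D = ℚ.>-nonZero (k-pos i≤D)

  ω : ℕ → ℚ
  ω i = inv (k D i)

  ω-balanced : ∀ {i} → i < D → ω (suc i) * bb D i ≡ ω i * cc D (suc i)
  ω-balanced {i} i<D =
    inv-*-swap (k D i) (k D (suc i)) (bb D i) (cc D (suc i))
               {{k≢0 (ℕP.<⇒≤ i<D)}} {{k≢0 i<D}} (k-balanced i<D)

  ω-one : ω 1 ≡ cc D 1 * inv (nℚ 3)
  ω-one = x*q≡y⇒x≡y*inv[q] (nℚ 3) {{ℚ.>-nonZero (nℚ-pos 3)}}
            (begin
              ω 1 * nℚ 3     ≡⟨ cong (ω 1 *_) (sym bb-zero) ⟩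
              ω 1 * bb D 0   ≡⟨ ω-balanced (ℕ.>-nonZero⁻¹ D) ⟩
              1ℚ * cc D 1    ≡⟨ ℚP.*-identityˡ (cc D 1) ⟩
              cc D 1         ∎)

  A : Mat D
  A = Amat D

  A-weightedSymmetric : WeightedSymmetric (k D ∘ toℕ) A
  A-weightedSymmetric r s = begin
    k D (toℕ r) * A r s                                  ≡⟨ cong (k D (toℕ r) *_) (Amat≡tridiag D r s) ⟩
    k D (toℕ r) * tridiag (aa D) (bb D) (cc D) (toℕ r) (toℕ s)
      ≡⟨ tridiag-weightedSymmetric (aa D) (bb D) (cc D) (k D) D (λ _ → k-balanced)
           (toℕ r) (toℕ s) (FinP.toℕ≤pred[n] r) (FinP.toℕ≤pred[n] s) ⟩
    k D (toℕ s) * tridiag (aa D) (bb D) (cc D) (toℕ s) (toℕ r) ≡⟨ cong (k D (toℕ s) *_) (sym (Amat≡tridiag D s r)) ⟩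
    k D (toℕ s) * A s r                                  ∎

  A-column₀ : ∀ t → A t Fin.zero ≡ aa D 0 * δ (toℕ t) 0 + cc D 1 * δ (toℕ t) 1
  A-column₀ t = trans (Amat≡tridiag D t Fin.zero) (tridiag-column₀ (aa D) (bb D) (cc D) (toℕ t))

  A-column : ∀ {j} (1+j<1+D : suc j < suc D) t →
             A t (fromℕ< 1+j<1+D) ≡
             bb D j * δ (toℕ t) j + aa D (suc j) * δ (toℕ t) (suc j) + cc D (suc (suc j)) * δ (toℕ t) (suc (suc j))
  A-column {j} 1+j<1+D t = begin
    A t (fromℕ< 1+j<1+D)                                        ≡⟨ Amat≡tridiag D t (fromℕ< 1+j<1+D) ⟩
    tridiag (aa D) (bb D) (cc D) (toℕ t) (toℕ (fromℕ< 1+j<1+D)) ≡⟨ cong (tridiag (aa D) (bb D) (cc D) (toℕ t))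
                                                                          (FinP.toℕ-fromℕ< 1+j<1+D) ⟩
    tridiag (aa D) (bb D) (cc D) (toℕ t) (suc j)                ≡⟨ tridiag-column (aa D) (bb D) (cc D) (toℕ t) j ⟩
    bb D j * δ (toℕ t) j + aa D (suc j) * δ (toℕ t) (suc j) + cc D (suc (suc j)) * δ (toℕ t) (suc (suc j))  ∎

  U : ℕ → Mat D
  U i = evalM (u D i) A

  U-column₀ : ∀ t → U 0 t Fin.zero ≡ ω 0 * δ (toℕ t) 0
  U-column₀ t = begin
    1ℚ * idM t Fin.zero + (A ⊗ zeroM) t Fin.zero
      ≡⟨ cong₂ (λ x y → 1ℚ * x + y) (idM≡δ t Fin.zero) (⊗-zeroʳ A t Fin.zero) ⟩
    1ℚ * δ (toℕ t) 0 + 0ℚ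
      ≡⟨ ℚP.+-identityʳ (1ℚ * δ (toℕ t) 0) ⟩
    1ℚ * δ (toℕ t) 0  ∎

  U-column₁ : ∀ t → U 1 t Fin.zero ≡ ω 1 * δ (toℕ t) 1
  U-column₁ t = begin
    U 1 t Fin.zero
      ≡⟨ evalM-pshift (inv (nℚ 3) ∷ []) A t Fin.zero ⟩
    (A ⊗ N) t Fin.zero
      ≡⟨ ⊗-column A N (inv (nℚ 3)) ℕ.z<s N-column t ⟩
    inv (nℚ 3) * A t Fin.zero
      ≡⟨ cong (inv (nℚ 3) *_) (A-column₀ t) ⟩
    inv (nℚ 3) * (aa D 0 * δ ρ 0 + cc D 1 * δ ρ 1)
      ≡⟨ cong (λ a → inv (nℚ 3) * (a * δ ρ 0 + cc D 1 * δ ρ 1)) aa-zero ⟩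
    inv (nℚ 3) * (0ℚ * δ ρ 0 + cc D 1 * δ ρ 1)
      ≡⟨ solve 4 (λ i c d₀ d₁ → i :* (con 0ℚ :* d₀ :+ c :* d₁) := c :* i :* d₁)
               refl (inv (nℚ 3)) (cc D 1) (δ ρ 0) (δ ρ 1) ⟩
    cc D 1 * inv (nℚ 3) * δ ρ 1
      ≡⟨ cong (_* δ ρ 1) (sym ω-one) ⟩
    ω 1 * δ ρ 1  ∎
    where
    ρ = toℕ t
    N = evalM (inv (nℚ 3) ∷ []) A
    N-column : ∀ s → N s Fin.zero ≡ inv (nℚ 3) * δ (toℕ s) 0
    N-column s = trans (cong₂ (λ x y → inv (nℚ 3) * x + y) (idM≡δ s Fin.zero) (⊗-zeroʳ A s Fin.zero))
                       (ℚP.+-identityʳ (inv (nℚ 3) * δ (toℕ s) 0))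

  U-column-step : ∀ n → suc (suc n) ≤ D →
                  (∀ t → U n t Fin.zero ≡ ω n * δ (toℕ t) n) →
                  (∀ t → U (suc n) t Fin.zero ≡ ω (suc n) * δ (toℕ t) (suc n)) →
                  ∀ t → U (suc (suc n)) t Fin.zero ≡ ω (suc (suc n)) * δ (toℕ t) (suc (suc n))
  U-column-step n 2+n≤D U₀-col U₁-col t = begin
    U (suc (suc n)) t Fin.zero
      ≡⟨ evalM-threeTerm β (0ℚ - a) (0ℚ - c₁) (u D (suc n)) (u D n) A t Fin.zero ⟩
    β * ((A ⊗ U (suc n)) t Fin.zero + ((0ℚ - a) * U (suc n) t Fin.zero + (0ℚ - c₁) * U n t Fin.zero))
      ≡⟨ cong (β *_) (cong₂ _+_ (trans (⊗-column A (U (suc n)) (ω (suc n)) (s≤s 1+n≤D) U₁-col t)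
                                        (cong (ω (suc n) *_) (A-column (s≤s 1+n≤D) t)))
                                 (cong₂ _+_ (cong ((0ℚ - a) *_) (U₁-col t)) (cong ((0ℚ - c₁) *_) (U₀-col t)))) ⟩
    β * (ω (suc n) * (bb D n * δ ρ n + a * δ ρ (suc n) + cc D (suc (suc n)) * δ ρ (suc (suc n)))
         + ((0ℚ - a) * (ω (suc n) * δ ρ (suc n)) + (0ℚ - c₁) * (ω n * δ ρ n)))
      ≡⟨ threeTerm-step β (ω n) (ω (suc n)) (ω (suc (suc n))) (bb D n) (bb D (suc n)) a c₁ (cc D (suc (suc n)))
                        (δ ρ n) (δ ρ (suc n)) (δ ρ (suc (suc n)))
                        (inv-inverseʳ (bb D (suc n)) {{ℚ.>-nonZero (bb-pos 2+n≤D)}})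
                        (ω-balanced 1+n≤D) (ω-balanced 2+n≤D) ⟩
    ω (suc (suc n)) * δ ρ (suc (suc n))  ∎
    where
    ρ = toℕ t
    1+n≤D = ℕP.<⇒≤ 2+n≤D
    β = inv (bb D (suc n))
    a = aa D (suc n)
    c₁ = cc D (suc n)

  U-column : ∀ i → i ≤ D → ∀ t → U i t Fin.zero ≡ ω i * δ (toℕ t) i
  U-column zero _ = U-column₀
  U-column (suc zero) _ = U-column₁
  U-column (suc (suc n)) 2+n≤D =
    U-column-step n 2+n≤D (U-column n (ℕP.<⇒≤ (ℕP.<⇒≤ 2+n≤D))) (U-column (suc n) (ℕP.<⇒≤ 2+n≤D))

  B-column : ∀ (j t : Fin (suc D)) → B D (toℕ j) t Fin.zero ≡ δ (toℕ t) (toℕ j)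
  B-column j t = begin
    B D (toℕ j) t Fin.zero                       ≡⟨ evalM-pscale kⱼ (u D (toℕ j)) A t Fin.zero ⟩
    kⱼ * U (toℕ j) t Fin.zero                    ≡⟨ cong (kⱼ *_) (U-column (toℕ j) j≤D t) ⟩
    kⱼ * (inv kⱼ * δ (toℕ t) (toℕ j))            ≡⟨ sym (ℚP.*-assoc kⱼ (inv kⱼ) (δ (toℕ t) (toℕ j))) ⟩
    kⱼ * inv kⱼ * δ (toℕ t) (toℕ j)              ≡⟨ cong (_* δ (toℕ t) (toℕ j)) (inv-inverseʳ kⱼ {{k≢0 j≤D}}) ⟩
    1ℚ * δ (toℕ t) (toℕ j)                       ≡⟨ ℚP.*-identityˡ (δ (toℕ t) (toℕ j)) ⟩
    δ (toℕ t) (toℕ j)                            ∎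
    where
    j≤D = FinP.toℕ≤pred[n] j
    kⱼ = k D (toℕ j)

  p≡B⊗B : ∀ h i j → p D h i j ≡ (B D (toℕ i) ⊗ B D (toℕ j)) h Fin.zero
  p≡B⊗B h i j = sym (begin
    (B D (toℕ i) ⊗ B D (toℕ j)) h Fin.zero   ≡⟨ ⊗-column (B D (toℕ i)) (B D (toℕ j)) 1ℚ (FinP.toℕ<n j)
                                                   (λ s → trans (B-column j s) (sym (ℚP.*-identityˡ _))) h ⟩
    1ℚ * B D (toℕ i) h (fromℕ< (FinP.toℕ<n j)) ≡⟨ ℚP.*-identityˡ _ ⟩
    B D (toℕ i) h (fromℕ< (FinP.toℕ<n j))    ≡⟨ cong (B D (toℕ i) h) (FinP.fromℕ<-toℕ j (FinP.toℕ<n j)) ⟩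
    B D (toℕ i) h j                          ∎)

  p-symmetric : ∀ h i j → p D h i j ≡ p D h j i
  p-symmetric h i j = begin
    p D h i j                                ≡⟨ p≡B⊗B h i j ⟩
    (B D (toℕ i) ⊗ B D (toℕ j)) h Fin.zero   ≡⟨ evalM-comm (v D (toℕ i)) (v D (toℕ j)) A h Fin.zero ⟩
    (B D (toℕ j) ⊗ B D (toℕ i)) h Fin.zero   ≡⟨ sym (p≡B⊗B h j i) ⟩
    p D h j i                                ∎

  p-weighted : ∀ h i j → k D (toℕ h) * p D h i j ≡ k D (toℕ j) * p D j h i
  p-weighted h i j = begin
    k D (toℕ h) * p D h i j  ≡⟨ weightedSymmetric-evalM {w = k D ∘ toℕ} (v D (toℕ i)) {A} A-weightedSymmetric h j ⟩
    k D (toℕ j) * p D j i h  ≡⟨ cong (k D (toℕ j) *_) (p-symmetric j i h) ⟩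
    k D (toℕ j) * p D j h i  ∎

lemma4p9 : (D : ℕ) → .{{_ : NonZero D}} → (h i j : Fin (suc D)) →
    (p D h i j ≡ p D h j i)
    × (k D (toℕ h) * p D h i j ≡ k D (toℕ j) * p D j h i)
    × (k D (toℕ j) * p D j h i ≡ k D (toℕ i) * p D i j h)
lemma4p9 D h i j = p-symmetric h i j , p-weighted h i j , p-weighted j h i
  where open Parameters D
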